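{- Let $G_P=(V,A_P)$ be a directed graph with distinguished nodes $s,e\in V$ such that $s$ has no predecessor in $G_P$. Let $X$ be a strongly connected component of $G_P$ that has exactly one indoor $i\in X$. Then every arc $(j,i)\in A_P$ with $j\in X$ is infeasible, i.e., no Hamiltonian path from $s$ to $e$ in $G_P$ contains the arc $(j,i)$.
   Context: A strongly connected component (SCC) of a directed graph is a maximal subgraph such that for every pair of its nodes $a,b$ there is a directed path from $a$ to $b$ and from $b$ to $a$. A node $i$ is an indoor of its SCC $X$ if $i$ has a predecessor (an in-neighbor in $G_P$) that does not belong to $X$. A Hamiltonian path from $s$ to $e$ is a directed simple path starting at $s$, ending at $e$, and visiting every node of $V$ exactly once. -}

module Defs where

open import Data.Nat using (ℕ)
open import Data.Fin using (Fin)
open import Data.List using (List; []; _∷_)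
open import Data.List.Membership.Propositional using (_∈_)
open import Data.List.Relation.Unary.Unique.Propositional using (Unique)
open import Data.Product using (Σ; ∃; _×_; _,_)
open import Relation.Binary.PropositionalEquality using (_≡_)
open import Relation.Binary.Construct.Closure.ReflexiveTransitive using (Star)
open import Relation.Nullary using (¬_)

-- A directed graph on the node set V = Fin n is given by its arc relation:
-- A u v  means  (u , v) is an arc.
Graph : ℕ → Set₁
Graph n = Fin n → Fin n → Set

module _ {n : ℕ} (A : Graph n) where

  Reach : Fin n → Fin n → Set
  Reach = Star A

  MutReach : Fin n → Fin n → Set
  MutReach a b = Reach a b × Reach b a

  IsSCC : (Fin n → Set) → Set
  IsSCC X = (∃ λ x → X x)
          × (∀ a b → X a → X b → MutReach a b)
          × (∀ a b → X a → MutReach a b → X b)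

  Indoor : (Fin n → Set) → Fin n → Set
  Indoor X i = X i × (∃ λ j → A j i × ¬ X j)

  data IsWalk : List (Fin n) → Set where
    walk-[] : IsWalk []
    walk-1  : ∀ x → IsWalk (x ∷ [])
    walk-∷  : ∀ x y xs → A x y → IsWalk (y ∷ xs) → IsWalk (x ∷ y ∷ xs)

  data LastIs (e : Fin n) : List (Fin n) → Set where
    last-1 : LastIs e (e ∷ [])
    last-∷ : ∀ x xs → LastIs e xs → LastIs e (x ∷ xs)

  data ContainsArc (j i : Fin n) : List (Fin n) → Set where
    here  : ∀ xs → ContainsArc j i (j ∷ i ∷ xs)
    there : ∀ x xs → ContainsArc j i xs → ContainsArc j i (x ∷ xs)

  record HamPath (s e : Fin n) (p : List (Fin n)) : Set where
    field
      walk   : IsWalk p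
      starts : ∃ λ ps → p ≡ s ∷ ps
      ends   : LastIs e p
      simple : Unique p
      covers : ∀ v → v ∈ p

module Submission where

-- Follow a Hamiltonian path p from s.  Since s has no
-- predecessor it cannot lie in X (every node of X reaches s, so s would need an
-- incoming arc, unless X = {s}, but i ∈ X has the predecessor j).  Hence p starts
-- outside X, and the first node of X met along p is entered from a node outside
-- X: it is an indoor of X, so it is i.  Up to that point every node is outside X,
-- so the arc (j , i) with j ∈ X has not been used yet; after that point i has
-- already been visited and, p being simple, cannot be entered again.
--
-- Membership in X is not decidable, so the case split on it is made
-- under double negation, which is harmless because the goal is ⊥.

open import Defs
open import Data.Nat using (ℕ)
open import Data.Fin using (Fin)
open import Data.List using (List; _∷_)
open import Data.List.Membership.Propositional using (_∈_)
open import Data.List.Relation.Unary.Any using (here; there)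
open import Data.List.Relation.Unary.All using (lookup)
open import Data.List.Relation.Unary.AllPairs using (_∷_)
open import Data.List.Relation.Unary.Unique.Propositional using (Unique)
open import Data.Product using (_,_; proj₁)
open import Data.Sum using (_⊎_; inj₁; inj₂)
open import Data.Empty using (⊥-elim)
open import Relation.Binary.PropositionalEquality using (_≡_; refl; subst)
open import Relation.Nullary using (¬_; yes; no)
open import Relation.Nullary.Decidable.Core using (¬¬-excluded-middle)
open import Relation.Binary.Construct.Closure.ReflexiveTransitive using (ε; _◅_)

module _ {n : ℕ} {A : Graph n} where

  reach-source : ∀ {a s} → (∀ j → ¬ A j s) → Reach A a s → a ≡ s
  reach-source noPred ε = refl
  reach-source noPred (arc ◅ path) =
    ⊥-elim (noPred _ (subst (A _) (reach-source noPred path) arc))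

  arc-target-visited : ∀ {j i} {xs : List (Fin n)} → ContainsArc A j i xs → i ∈ xs
  arc-target-visited (here _)        = there (here refl)
  arc-target-visited (there _ _ arc) = there (arc-target-visited arc)

  arc-target-in-tail : ∀ {j i x} {xs : List (Fin n)} →
                       ContainsArc A j i (x ∷ xs) → i ∈ xs
  arc-target-in-tail (here _)        = here refl
  arc-target-in-tail (there _ _ arc) = arc-target-visited arc

  no-arc-into-head : ∀ {j x} {xs : List (Fin n)} →
                     Unique (x ∷ xs) → ¬ ContainsArc A j x (x ∷ xs)
  no-arc-into-head (x∉xs ∷ _) arc = lookup x∉xs (arc-target-in-tail arc) refl

  OutsideOrIndoor : (Fin n → Set) → Fin n → Set
  OutsideOrIndoor X x = ¬ X x ⊎ Indoor A X x

  step-from-outside : ∀ {X x y} → ¬ X x → A x y → ¬ ¬ OutsideOrIndoor X y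
  step-from-outside {x = x} x∉X arc k = ¬¬-excluded-middle λ where
    (yes y∈X) → k (inj₂ (y∈X , x , arc , x∉X))
    (no  y∉X) → k (inj₁ y∉X)

  no-arc-from-inside : ∀ (X : Fin n → Set) {i j} →
    (∀ k → Indoor A X k → k ≡ i) → X j →
    ∀ x (xs : List (Fin n)) → OutsideOrIndoor X x →
    IsWalk A (x ∷ xs) → Unique (x ∷ xs) → ¬ ContainsArc A j i (x ∷ xs)
  no-arc-from-inside X only-i j∈X x xs (inj₂ x-indoor) _ simple arc
    with only-i x x-indoor
  ... | refl = no-arc-into-head simple arc
  no-arc-from-inside X only-i j∈X x xs (inj₁ x∉X) _ _ (here _) = x∉X j∈X
  no-arc-from-inside X only-i j∈X x (y ∷ ys) (inj₁ x∉X)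
    (walk-∷ _ _ _ x→y walk) (_ ∷ simple) (there _ _ arc) =
    step-from-outside x∉X x→y λ inv →
      no-arc-from-inside X only-i j∈X y ys inv walk simple arc

proposition3 : ∀ {n : ℕ} (A : Graph n) (s e : Fin n) →
    (∀ j → ¬ A j s) →
    (X : Fin n → Set) → IsSCC A X →
    (i : Fin n) → Indoor A X i → (∀ k → Indoor A X k → k ≡ i) →
    ∀ j → X j → A j i →
    ∀ (p : List (Fin n)) → HamPath A s e p → ¬ ContainsArc A j i p
proposition3 A s e noPred X (_ , mutually-reachable , _) i (i∈X , _) only-i j j∈X j→i p ham
  with HamPath.starts ham
... | ps , refl =
  no-arc-from-inside X only-i j∈X s ps (inj₁ s∉X) (HamPath.walk ham) (HamPath.simple ham)
  where
  -- s ∉ X: otherwise i reaches s, forcing i ≡ s, yet i has the predecessor j.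
  s∉X : ¬ X s
  s∉X s∈X with reach-source noPred (proj₁ (mutually-reachable i s i∈X s∈X))
  ... | refl = noPred j j→i
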